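{- If $\mathcal I$ is a small step alternating pushdown system and $\mathcal I_s$ is its saturation, then $\mathcal I$ and $\mathcal I_s$ prove the same configurations.
   Context: Fix a language with finitely many unary predicate symbols (states), finitely many unary function symbols (stack symbols), a constant $\varepsilon$ and a variable $x$. Words are closed terms $\gamma_1(\cdots\gamma_n(\varepsilon))$, written $\gamma_1\cdots\gamma_n$; configurations are atomic propositions $P(w)$ with $P$ a state and $w$ a word. A proof of a configuration in a set of rules is a finite tree labeled by configurations where each node is labeled $\sigma B$ and its children $\sigma A_1,\dots,\sigma A_n$ for some rule $\frac{A_1\cdots A_n}{B}$ of the system and some substitution $\sigma$ of a word for $x$. Premises of a rule are regarded as a finite set. Rule types: an introduction rule is $\frac{P_1(x)\cdots P_n(x)}{Q(\gamma x)}$ ($\gamma$ a stack symbol, $n\ge0$) or $\frac{}{Q(\varepsilon)}$; an elimination rule is $\frac{P_1(\gamma x)\ P_2(x)\cdots P_n(x)}{Q(x)}$ ($n\ge1$); a neutral rule is $\frac{P_1(x)\cdots P_n(x)}{Q(x)}$ ($n\ge0$). A small step alternating pushdown system is a finite set of introduction, elimination and neutral rules. The saturation $\mathcal I_s$ of $\mathcal I$ is the smallest set of rules containing $\mathcal I$ and closed under: (1) if it contains an introduction rule $\frac{P_1(x)\cdots P_m(x)}{Q_1(\gamma x)}$ and an elimination rule $\frac{Q_1(\gamma x)\ Q_2(x)\cdots Q_n(x)}{R(x)}$, it contains the neutral rule $\frac{P_1(x)\cdots P_m(x)\ Q_2(x)\cdots Q_n(x)}{R(x)}$; (2) if for a stack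 symbol $\gamma$ it contains introduction rules $\frac{P^i_1(x)\cdots P^i_{m_i}(x)}{Q_i(\gamma x)}$ ($i=1,\dots,n$) and a neutral rule $\frac{Q_1(x)\cdots Q_n(x)}{R(x)}$ ($n\ge0$), it contains the introduction rule $\frac{P^1_1(x)\cdots P^1_{m_1}(x)\ \cdots\ P^n_1(x)\cdots P^n_{m_n}(x)}{R(\gamma x)}$ (for $n=0$: $\frac{}{R(\gamma x)}$ for every $\gamma$); (3) if it contains introduction rules $\frac{}{Q_i(\varepsilon)}$ ($i=1,\dots,n$) and a neutral rule $\frac{Q_1(x)\cdots Q_n(x)}{R(x)}$ ($n\ge0$), it contains $\frac{}{R(\varepsilon)}$. This set is finite. -}

module Defs where

open import Data.Nat using (ℕ)
open import Data.Fin using (Fin)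
open import Data.List using (List; []; _∷_; map; concat; _++_)
open import Data.List.Relation.Unary.All using (All)
open import Data.List.Relation.Binary.Pointwise using (Pointwise)
open import Data.Product using (_×_; _,_; ∃; ∃-syntax)
open import Data.Sum using (_⊎_)
open import Relation.Binary.PropositionalEquality using (_≡_)

-- Fixed language: nS states (unary predicate symbols) and nG stack symbols
-- (unary function symbols), a constant ε and a single variable x.
module _ {nS nG : ℕ} where

  State = Fin nS
  Sym   = Fin nG

  data Term : Set where
    var : Term
    eps : Term
    app : Sym → Term → Term

  Atom : Set
  Atom = State × Term

  -- a rule A₁ ⋯ Aₙ / B ; the (finite set of) premises is given as a list
  record Rule : Set where
    constructor _⊢_
    field
      prems : List Atom
      concl : Atom
  open Rule public

  -- words γ₁⋯γₙ = γ₁(⋯γₙ(ε)) are lists of stack symbols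
  Word : Set
  Word = List Sym

  Config : Set
  Config = State × Word

  _[_] : Term → Word → Word
  var     [ w ] = w
  eps     [ w ] = []
  app γ t [ w ] = γ ∷ (t [ w ])

  inst : Atom → Word → Config
  inst (P , t) w = P , (t [ w ])

  data Proves (Φ : Rule → Set) : Config → Set where
    node : ∀ {r} → Φ r → (w : Word) →
           All (λ A → Proves Φ (inst A w)) (prems r) →
           Proves Φ (inst (concl r) w)

  onX : List State → List Atom
  onX = map (λ P → P , var)

  introR : List State → State → Sym → Rule
  introR Ps Q γ = onX Ps ⊢ (Q , app γ var)

  introεR : State → Rule
  introεR Q = [] ⊢ (Q , eps)

  elimR : State → Sym → List State → State → Rule
  elimR P₁ γ Ps Q = ((P₁ , app γ var) ∷ onX Ps) ⊢ (Q , var)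

  neutR : List State → State → Rule
  neutR Ps Q = onX Ps ⊢ (Q , var)

  IsIntro : Rule → Set
  IsIntro r = (∃[ Ps ] ∃[ Q ] ∃[ γ ] r ≡ introR Ps Q γ) ⊎ (∃[ Q ] r ≡ introεR Q)

  IsElim : Rule → Set
  IsElim r = ∃[ P₁ ] ∃[ γ ] ∃[ Ps ] ∃[ Q ] r ≡ elimR P₁ γ Ps Q

  IsNeutral : Rule → Set
  IsNeutral r = ∃[ Ps ] ∃[ Q ] r ≡ neutR Ps Q

  SmallStep : List Rule → Set
  SmallStep I = All (λ r → IsIntro r ⊎ IsElim r ⊎ IsNeutral r) I

  data _∈R_ (r : Rule) : List Rule → Set where
    here  : ∀ {I} → r ∈R (r ∷ I)
    there : ∀ {s I} → r ∈R I → r ∈R (s ∷ I)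

  data Sat (I : List Rule) : Rule → Set where
    base : ∀ {r} → r ∈R I → Sat I r
    cut  : ∀ {Ps Q₁ γ Qs R} →
           Sat I (introR Ps Q₁ γ) → Sat I (elimR Q₁ γ Qs R) →
           Sat I (neutR (Ps ++ Qs) R)
    push : ∀ {γ Qs R} (Pss : List (List State)) →
           Pointwise (λ Q Ps → Sat I (introR Ps Q γ)) Qs Pss →
           Sat I (neutR Qs R) →
           Sat I (introR (concat Pss) R γ)
    pushε : ∀ {Qs R} →
            All (λ Q → Sat I (introεR Q)) Qs →
            Sat I (neutR Qs R) →
            Sat I (introεR R)

module Submission where

-- The proof rests on two
-- general facts about arbitrary rule sets Φ, Ψ:
--   * if every Ψ-rule is admissible for Φ, then whatever Ψ proves, Φ proves
--     (replace each Ψ-step by the Φ-derivation it stands for);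
--   * every rule of Φ is admissible for Φ, hence for any superset of Φ.
-- Next, each of the three saturation clauses (1)-(3) preserves admissibility,
-- for any Φ: a cut of admissible rules, a push of admissible rules through a
-- neutral rule (over γ or over ε) are again admissible.  By induction on the
-- derivation of membership in I_s, every rule of the saturation I_s is thus
-- admissible for I.  The theorem follows: I ⊆ I_s gives one inclusion of the
-- provable configurations, admissibility of I_s for I the other.

open import Defs
open import Data.Nat using (ℕ)
open import Data.List using (List; []; _∷_; _++_; concat)
open import Data.List.Relation.Unary.All using (All; []; _∷_)
open import Data.List.Relation.Unary.All.Properties using (map⁺; map⁻; ++⁻; concat⁻)
open import Data.List.Relation.Binary.Pointwise using (Pointwise; []; _∷_)
open import Data.Product using (_×_; _,_)

module _ {nS nG : ℕ} where

  RuleSet : Set₁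
  RuleSet = Rule {nS} {nG} → Set

  ProvableAt : RuleSet → Word {nS} {nG} → List (Atom {nS} {nG}) → Set
  ProvableAt Φ w As = All (λ A → Proves Φ (inst A w)) As

  Admissible : RuleSet → Rule {nS} {nG} → Set
  Admissible Φ r = ∀ w → ProvableAt Φ w (prems r) → Proves Φ (inst (concl r) w)

  fromOnX : ∀ {Φ w} (Ps : List (State {nS} {nG})) → ProvableAt Φ w (onX Ps) → All (λ P → Proves Φ (P , w)) Ps
  fromOnX _ = map⁻

  toOnX : ∀ {Φ w} {Ps : List (State {nS} {nG})} →
          All (λ P → Proves Φ (P , w)) Ps → ProvableAt Φ w (onX Ps)
  toOnX = map⁺

  member-admissible : ∀ {Φ Ψ : RuleSet} → (∀ {r} → Φ r → Ψ r) →
                      ∀ {r} → Φ r → Admissible Ψ r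
  member-admissible Φ⊆Ψ r∈Φ w ps = node (Φ⊆Ψ r∈Φ) w ps

  module _ {Φ Ψ : RuleSet} (admissible : ∀ {r} → Ψ r → Admissible Φ r) where
    mutual
      translate : ∀ {c} → Proves Ψ c → Proves Φ c
      translate (node r∈Ψ w ps) = admissible r∈Ψ w (translateAll ps)

      translateAll : ∀ {w As} → ProvableAt Ψ w As → ProvableAt Φ w As
      translateAll []       = []
      translateAll (p ∷ ps) = translate p ∷ translateAll ps

  module _ {Φ : RuleSet} where

    cut-admissible : ∀ {Ps Q₁ γ Qs R} →
                     Admissible Φ (introR Ps Q₁ γ) → Admissible Φ (elimR Q₁ γ Qs R) →
                     Admissible Φ (neutR (Ps ++ Qs) R)
    cut-admissible {Ps} intro elim w ps with ++⁻ Ps (fromOnX (Ps ++ _) ps)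
    ... | ps₁ , qs = elim w (intro w (toOnX ps₁) ∷ toOnX qs)

    push-premises : ∀ {γ Qs Pss w} →
                    Pointwise (λ Q Ps → Admissible Φ (introR Ps Q γ)) Qs Pss →
                    All (All (λ P → Proves Φ (P , w))) Pss →
                    All (λ Q → Proves Φ (Q , γ ∷ w)) Qs
    push-premises []                _            = []
    push-premises {w = w} (intro ∷ intros) (ps ∷ pss) =
      intro w (toOnX ps) ∷ push-premises intros pss

    push-admissible : ∀ {γ Qs R} Pss →
                      Pointwise (λ Q Ps → Admissible Φ (introR Ps Q γ)) Qs Pss →
                      Admissible Φ (neutR Qs R) →
                      Admissible Φ (introR (concat Pss) R γ)
    push-admissible {γ} Pss intros neut w ps =
      neut (γ ∷ w) (toOnX (push-premises intros (concat⁻ (fromOnX (concat Pss) ps))))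

    pushε-admissible : ∀ {Qs R} →
                       All (λ Q → Admissible Φ (introεR Q)) Qs →
                       Admissible Φ (neutR Qs R) →
                       Admissible Φ (introεR R)
    pushε-admissible intros neut _ [] = neut [] (toOnX (atε intros))
      where
      atε : ∀ {Qs} → All (λ Q → Admissible Φ (introεR Q)) Qs →
            All (λ Q → Proves Φ (Q , [])) Qs
      atε []               = []
      atε (intro ∷ intros) = intro [] [] ∷ atε intros

  module _ (I : List (Rule {nS} {nG})) where
    mutual
      saturation-admissible : ∀ {r} → Sat I r → Admissible (_∈R I) r
      saturation-admissible (base r∈I)       = member-admissible (λ r∈I → r∈I) r∈I
      saturation-admissible (cut intro elim) =
        cut-admissible (saturation-admissible intro) (saturation-admissible elim)
      saturation-admissible (push Pss intros neut) =
        push-admissible Pss (admissible-pointwise intros) (saturation-admissible neut)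
      saturation-admissible (pushε intros neut) =
        pushε-admissible (admissible-all intros) (saturation-admissible neut)

      admissible-pointwise : ∀ {γ Qs Pss} →
                             Pointwise (λ Q Ps → Sat I (introR Ps Q γ)) Qs Pss →
                             Pointwise (λ Q Ps → Admissible (_∈R I) (introR Ps Q γ)) Qs Pss
      admissible-pointwise []           = []
      admissible-pointwise (s ∷ intros) =
        saturation-admissible s ∷ admissible-pointwise intros

      admissible-all : ∀ {Qs} → All (λ Q → Sat I (introεR Q)) Qs →
                       All (λ Q → Admissible (_∈R I) (introεR Q)) Qs
      admissible-all []           = []
      admissible-all (s ∷ intros) = saturation-admissible s ∷ admissible-all intros

lemma3 : {nS nG : ℕ} (I : List (Rule {nS} {nG})) → SmallStep I →
    (c : Config {nS} {nG}) →
    ((Proves (λ r → r ∈R I) c → Proves (Sat I) c) ×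
    (Proves (Sat I) c → Proves (λ r → r ∈R I) c))
lemma3 I _ _ =
  translate (member-admissible (Sat.base {I = I})) ,
  translate (saturation-admissible I)
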